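{- Let $q=p^n$ with $p$ prime, let $f\in \mathbb{F}_q[x]$, and let $m,b\in\mathbb{F}_q$. Suppose the line $\{(x,y)\in\mathbb{F}_q^2 : y=mx+b\}$ meets the graph $\{(x,f(x)) : x\in\mathbb{F}_q\}$ of $f$ in exactly $k$ points, where $1<k<q$. Then \[|(D_f-m)^{ -1}(D_f-m)|\geq q-k+2.\]
   Context: For $f\in\mathbb{F}_q[x]$ (viewed as a function $\mathbb{F}_q\to\mathbb{F}_q$), the set of directions determined by $f$ is $D_f=\{(f(x)-f(y))/(x-y) : x,y\in\mathbb{F}_q,\ x\neq y\}$. For $A,B\subseteq\mathbb{F}_q$ and $c\in\mathbb{F}_q$: $A-c=\{a-c : a\in A\}$; $A^{ -1}=\{a^{ -1} : a\in A\setminus\{0\}\}$; $AB=\{ab : a\in A,\ b\in B\}$. -}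

module Defs where

open import Level using (0ℓ)
open import Data.Nat using (ℕ)
open import Data.List using (List; []; _∷_; length; filter)
open import Data.List.Membership.Propositional using (_∈_)
open import Data.List.Relation.Unary.Unique.Propositional using (Unique)
open import Data.Product using (∃; ∃-syntax; _×_)
open import Relation.Binary.PropositionalEquality using (_≡_; _≢_)
open import Relation.Binary.Definitions using (DecidableEquality)
open import Algebra.Structures using (IsCommutativeRing)

record FiniteField : Set₁ where
  infixl 7 _*_
  infixl 6 _+_ _-_
  field
    Carrier : Set
    _+_ _*_ : Carrier → Carrier → Carrier
    -_ : Carrier → Carrier
    0# 1# : Carrier
    isCommutativeRing : IsCommutativeRing _≡_ _+_ _*_ -_ 0# 1#
    0≢1 : 0# ≢ 1#
    _⁻¹ : Carrier → Carrier
    ⁻¹-inverse : ∀ x → x ≢ 0# → x * (x ⁻¹) ≡ 1#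
    _≟_ : DecidableEquality Carrier
    elements : List Carrier
    elements-unique : Unique elements
    elements-complete : ∀ x → x ∈ elements

  _-_ : Carrier → Carrier → Carrier
  x - y = x + (- y)

  size : ℕ
  size = length elements

module _ (F : FiniteField) where
  open FiniteField F

  -- Polynomials over F as coefficient lists (constant term first).
  Poly : Set
  Poly = List Carrier

  eval : Poly → Carrier → Carrier
  eval [] x = 0#
  eval (c ∷ cs) x = c + x * eval cs x

  InDirections : (Carrier → Carrier) → Carrier → Set
  InDirections f d = ∃[ x ] ∃[ y ] (x ≢ y × d ≡ (f x - f y) * ((x - y) ⁻¹))

  InQuotSet : (Carrier → Carrier) → Carrier → Carrier → Set
  InQuotSet f m z = ∃[ a ] ∃[ b ]
    (InDirections f a × InDirections f b × (a - m) ≢ 0# × z ≡ ((a - m) ⁻¹) * (b - m))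

  intersectionCount : (Carrier → Carrier) → Carrier → Carrier → ℕ
  intersectionCount f m b = length (filter (λ x → f x ≟ (m * x + b)) elements)

{-# OPTIONS --safe #-}
module Submission where

-- Fix two points z₀ ≠ z₁ where the graph of f meets the line. For x off the line,
-- g = f x − (m x + b) ≠ 0 and the secant slopes satisfy d(x, zᵢ) − m = g / (x − zᵢ),
-- so (d(x, z₀) − m)⁻¹ (d(x, z₁) − m) = (x − z₀) / (x − z₁) = 1 + (z₁ − z₀) / (x − z₁).
-- This is injective in x and never 0 or 1; adding 0 (from d(z₁, z₀) = m) and 1 gives
-- q − k + 2 distinct elements.

open import Defs
open import Level using (0ℓ)
open import Algebra.Bundles using (CommutativeRing)
open import Data.Nat using (ℕ; suc; s≤s; _<_; _≤_; _∸_; _^_)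
open import Data.Nat.Primality using (Prime)
open import Data.Nat.Properties using (+-suc; +-comm; m+n∸m≡n; m<n⇒0<n∸m; ≤-reflexive)
open import Data.List using (List; []; _∷_; length; filter; map)
open import Data.List.Properties using (length-map)
open import Data.List.Relation.Unary.All as All using (All; []; _∷_)
open import Data.List.Relation.Unary.All.Properties using (all-filter; map⁺)
open import Data.List.Relation.Unary.AllPairs using ([]; _∷_)
open import Data.List.Relation.Unary.Unique.Propositional using (Unique)
open import Data.List.Relation.Unary.Unique.Propositional.Properties using (filter⁺)
open import Data.Product using (∃; ∃-syntax; _×_; _,_)
open import Function using (_∘_)
open import Relation.Nullary using (¬_; yes; no)
open import Relation.Unary using (Pred; Decidable; ∁)
open import Relation.Unary.Properties using (∁?)
open import Relation.Binary.PropositionalEquality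
  using (_≡_; _≢_; refl; sym; trans; cong; cong₂; subst; module ≡-Reasoning)

module _ {A : Set} {P : Pred A 0ℓ} where

  All-nonempty⇒∃ : ∀ {xs} → 0 < length xs → All P xs → ∃ P
  All-nonempty⇒∃ {x ∷ _} _ (px ∷ _) = x , px

  All-Unique⇒distinct-pair : ∀ {xs} → 1 < length xs → All P xs → Unique xs →
    ∃[ x ] ∃[ y ] (P x × P y × x ≢ y)
  All-Unique⇒distinct-pair {_ ∷ []}    (s≤s ())
  All-Unique⇒distinct-pair {x ∷ y ∷ _} _ (px ∷ py ∷ _) ((x≢y ∷ _) ∷ _) = x , y , px , py , x≢y

module _ {A B : Set} {P : Pred A 0ℓ} {f : A → B}
         (f-injectiveOn : ∀ {x y} → P x → P y → f x ≡ f y → x ≡ y) where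

  Unique-map⁺ : ∀ {xs} → All P xs → Unique xs → Unique (map f xs)
  Unique-map⁺ []         []            = []
  Unique-map⁺ (px ∷ pxs) (x∉xs ∷ xs!) =
    map⁺ (All.zipWith (λ (py , x≢y) fx≡fy → x≢y (f-injectiveOn px py fx≡fy)) (pxs , x∉xs))
    ∷ Unique-map⁺ pxs xs!

module FieldProperties (F : FiniteField) where
  open FiniteField F
  open ≡-Reasoning

  commutativeRing : CommutativeRing 0ℓ 0ℓ
  commutativeRing = record { isCommutativeRing = isCommutativeRing }

  private module R = CommutativeRing commutativeRing
  open import Algebra.Properties.Ring R.ring
    using (x∙y⁻¹≈ε⇒x≈y; //-rightDividesˡ; //-rightDividesʳ; -‿anti-homo-+; +-cancelˡ; +-cancelʳ)
  open import Algebra.Properties.CommutativeSemigroup R.*-commutativeSemigroup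
    using (interchange)

  infixl 7 _/_
  _/_ : Carrier → Carrier → Carrier
  x / y = x * y ⁻¹

  x-z≡[x-y]+[y-z] : ∀ x y z → x - z ≡ (x - y) + (y - z)
  x-z≡[x-y]+[y-z] x y z = begin
    x - z               ≡⟨ cong (_- z) (//-rightDividesˡ y x) ⟨
    (x - y) + y - z     ≡⟨ R.+-assoc (x - y) y (- z) ⟩
    (x - y) + (y - z)   ∎

  [x+w]-[y+w]≡x-y : ∀ x y w → (x + w) - (y + w) ≡ x - y
  [x+w]-[y+w]≡x-y x y w = begin
    (x + w) + - (y + w)   ≡⟨ cong ((x + w) +_) (-‿anti-homo-+ y w) ⟩
    (x + w) + (- w + - y) ≡⟨ R.+-assoc (x + w) (- w) (- y) ⟨
    (x + w) - w - y       ≡⟨ cong (_- y) (//-rightDividesʳ w x) ⟩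
    x - y                 ∎

  x≢y⇒x-y≢0 : ∀ {x y} → x ≢ y → x - y ≢ 0#
  x≢y⇒x-y≢0 x≢y x-y≡0 = x≢y (x∙y⁻¹≈ε⇒x≈y _ _ x-y≡0)

  ⁻¹-inverseˡ : ∀ {x} → x ≢ 0# → x ⁻¹ * x ≡ 1#
  ⁻¹-inverseˡ {x} x≢0 = trans (R.*-comm (x ⁻¹) x) (⁻¹-inverse x x≢0)

  x⁻¹*[x*y]≡y : ∀ {x} → x ≢ 0# → ∀ y → x ⁻¹ * (x * y) ≡ y
  x⁻¹*[x*y]≡y {x} x≢0 y = begin
    x ⁻¹ * (x * y) ≡⟨ R.*-assoc (x ⁻¹) x y ⟨
    x ⁻¹ * x * y   ≡⟨ cong (_* y) (⁻¹-inverseˡ x≢0) ⟩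
    1# * y         ≡⟨ R.*-identityˡ y ⟩
    y              ∎

  *-cancelˡ : ∀ {x y z} → x ≢ 0# → x * y ≡ x * z → y ≡ z
  *-cancelˡ {x} {y} {z} x≢0 xy≡xz = begin
    y              ≡⟨ x⁻¹*[x*y]≡y x≢0 y ⟨
    x ⁻¹ * (x * y) ≡⟨ cong (x ⁻¹ *_) xy≡xz ⟩
    x ⁻¹ * (x * z) ≡⟨ x⁻¹*[x*y]≡y x≢0 z ⟩
    z              ∎

  x*y≢0 : ∀ {x y} → x ≢ 0# → y ≢ 0# → x * y ≢ 0#
  x*y≢0 {x} x≢0 y≢0 xy≡0 = y≢0 (*-cancelˡ x≢0 (trans xy≡0 (sym (R.zeroʳ x))))

  x⁻¹≢0 : ∀ {x} → x ≢ 0# → x ⁻¹ ≢ 0#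
  x⁻¹≢0 {x} x≢0 x⁻¹≡0 = 0≢1 (begin
    0#       ≡⟨ R.zeroʳ x ⟨
    x * 0#   ≡⟨ cong (x *_) x⁻¹≡0 ⟨
    x * x ⁻¹ ≡⟨ ⁻¹-inverse x x≢0 ⟩
    1#       ∎)

  x/y≢0 : ∀ {x y} → x ≢ 0# → y ≢ 0# → x / y ≢ 0#
  x/y≢0 x≢0 y≢0 = x*y≢0 x≢0 (x⁻¹≢0 y≢0)

  ⁻¹-unique : ∀ {x y} → x ≢ 0# → x * y ≡ 1# → y ≡ x ⁻¹
  ⁻¹-unique {x} x≢0 xy≡1 = *-cancelˡ x≢0 (trans xy≡1 (sym (⁻¹-inverse x x≢0)))

  ⁻¹-involutive : ∀ {x} → x ≢ 0# → x ⁻¹ ⁻¹ ≡ x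
  ⁻¹-involutive x≢0 = sym (⁻¹-unique (x⁻¹≢0 x≢0) (⁻¹-inverseˡ x≢0))

  ⁻¹-injective : ∀ {x y} → x ≢ 0# → y ≢ 0# → x ⁻¹ ≡ y ⁻¹ → x ≡ y
  ⁻¹-injective {x} {y} x≢0 y≢0 x⁻¹≡y⁻¹ = begin
    x         ≡⟨ ⁻¹-involutive x≢0 ⟨
    x ⁻¹ ⁻¹   ≡⟨ cong _⁻¹ x⁻¹≡y⁻¹ ⟩
    y ⁻¹ ⁻¹   ≡⟨ ⁻¹-involutive y≢0 ⟩
    y         ∎

  ⁻¹-distrib-* : ∀ {x y} → x ≢ 0# → y ≢ 0# → (x * y) ⁻¹ ≡ x ⁻¹ * y ⁻¹
  ⁻¹-distrib-* {x} {y} x≢0 y≢0 = sym (⁻¹-unique (x*y≢0 x≢0 y≢0) (begin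
    (x * y) * (x ⁻¹ * y ⁻¹)   ≡⟨ interchange x y (x ⁻¹) (y ⁻¹) ⟩
    (x * x ⁻¹) * (y * y ⁻¹)   ≡⟨ cong₂ _*_ (⁻¹-inverse x x≢0) (⁻¹-inverse y y≢0) ⟩
    1# * 1#                   ≡⟨ R.*-identityˡ 1# ⟩
    1#                        ∎))

  x*y/y≡x : ∀ x {y} → y ≢ 0# → x * y / y ≡ x
  x*y/y≡x x {y} y≢0 = begin
    x * y * y ⁻¹   ≡⟨ R.*-assoc x y (y ⁻¹) ⟩
    x * (y * y ⁻¹) ≡⟨ cong (x *_) (⁻¹-inverse y y≢0) ⟩
    x * 1#         ≡⟨ R.*-identityʳ x ⟩
    x              ∎

  [x+y]/x≡1+y/x : ∀ {x} y → x ≢ 0# → (x + y) / x ≡ 1# + y / x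
  [x+y]/x≡1+y/x {x} y x≢0 = begin
    (x + y) / x    ≡⟨ R.distribʳ (x ⁻¹) x y ⟩
    x / x + y / x  ≡⟨ cong (_+ y / x) (⁻¹-inverse x x≢0) ⟩
    1# + y / x     ∎

  [x/y]⁻¹*[x/z]≡y/z : ∀ {x y} z → x ≢ 0# → y ≢ 0# → (x / y) ⁻¹ * (x / z) ≡ y / z
  [x/y]⁻¹*[x/z]≡y/z {x} {y} z x≢0 y≢0 = begin
    (x / y) ⁻¹ * (x / z)          ≡⟨ cong (_* (x / z)) (⁻¹-distrib-* x≢0 (x⁻¹≢0 y≢0)) ⟩
    (x ⁻¹ * y ⁻¹ ⁻¹) * (x / z)    ≡⟨ cong (λ t → (x ⁻¹ * t) * (x / z)) (⁻¹-involutive y≢0) ⟩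
    (x ⁻¹ * y) * (x * z ⁻¹)       ≡⟨ interchange (x ⁻¹) y x (z ⁻¹) ⟩
    (x ⁻¹ * x) * (y / z)          ≡⟨ cong (_* (y / z)) (⁻¹-inverseˡ x≢0) ⟩
    1# * (y / z)                  ≡⟨ R.*-identityˡ (y / z) ⟩
    y / z                         ∎

  module CrossRatio {z₀ z₁ : Carrier} (z₀≢z₁ : z₀ ≢ z₁) where

    ratio : Carrier → Carrier
    ratio x = (x - z₀) / (x - z₁)

    ratio≡1+[z₁-z₀]/[x-z₁] : ∀ {x} → x ≢ z₁ → ratio x ≡ 1# + (z₁ - z₀) / (x - z₁)
    ratio≡1+[z₁-z₀]/[x-z₁] {x} x≢z₁ = begin
      (x - z₀) / (x - z₁)                 ≡⟨ cong (_/ (x - z₁)) (x-z≡[x-y]+[y-z] x z₁ z₀) ⟩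
      ((x - z₁) + (z₁ - z₀)) / (x - z₁)   ≡⟨ [x+y]/x≡1+y/x (z₁ - z₀) (x≢y⇒x-y≢0 x≢z₁) ⟩
      1# + (z₁ - z₀) / (x - z₁)           ∎

    ratio≢0 : ∀ {x} → x ≢ z₀ → x ≢ z₁ → ratio x ≢ 0#
    ratio≢0 x≢z₀ x≢z₁ = x/y≢0 (x≢y⇒x-y≢0 x≢z₀) (x≢y⇒x-y≢0 x≢z₁)

    ratio≢1 : ∀ {x} → x ≢ z₁ → ratio x ≢ 1#
    ratio≢1 {x} x≢z₁ ratio≡1 = x/y≢0 (x≢y⇒x-y≢0 (z₀≢z₁ ∘ sym)) (x≢y⇒x-y≢0 x≢z₁)
      (+-cancelˡ 1# _ _ (begin
        1# + (z₁ - z₀) / (x - z₁)   ≡⟨ ratio≡1+[z₁-z₀]/[x-z₁] x≢z₁ ⟨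
        ratio x                     ≡⟨ ratio≡1 ⟩
        1#                          ≡⟨ R.+-identityʳ 1# ⟨
        1# + 0#                     ∎))

    ratio-injective : ∀ {x y} → x ≢ z₁ → y ≢ z₁ → ratio x ≡ ratio y → x ≡ y
    ratio-injective {x} {y} x≢z₁ y≢z₁ ratio-x≡ratio-y =
      +-cancelʳ (- z₁) x y (⁻¹-injective (x≢y⇒x-y≢0 x≢z₁) (x≢y⇒x-y≢0 y≢z₁)
        (*-cancelˡ (x≢y⇒x-y≢0 (z₀≢z₁ ∘ sym)) (+-cancelˡ 1# _ _ (begin
          1# + (z₁ - z₀) / (x - z₁)   ≡⟨ ratio≡1+[z₁-z₀]/[x-z₁] x≢z₁ ⟨
          ratio x                     ≡⟨ ratio-x≡ratio-y ⟩
          ratio y                     ≡⟨ ratio≡1+[z₁-z₀]/[x-z₁] y≢z₁ ⟩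
          1# + (z₁ - z₀) / (y - z₁)   ∎))))

module Secants (F : FiniteField) (φ : FiniteField.Carrier F → FiniteField.Carrier F)
               (m b : FiniteField.Carrier F) where
  open FiniteField F
  open FieldProperties F
  open ≡-Reasoning

  private module R = CommutativeRing commutativeRing
  open import Algebra.Properties.Ring R.ring using (x∙y⁻¹≈ε⇒x≈y; //-rightDividesʳ; x[y-z]≈xy-xz)

  line : Carrier → Carrier
  line x = m * x + b

  OnLine : Pred Carrier 0ℓ
  OnLine x = φ x ≡ line x

  onLine? : Decidable OnLine
  onLine? x = φ x ≟ line x

  gap : Carrier → Carrier
  gap x = φ x - line x

  slope : Carrier → Carrier → Carrier
  slope x z = (φ x - φ z) / (x - z)

  slope∈directions : ∀ {x z} → x ≢ z → InDirections F φ (slope x z)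
  slope∈directions {x} {z} x≢z = x , z , x≢z , refl

  offLine⇒≢ : ∀ {x z} → ¬ OnLine x → OnLine z → x ≢ z
  offLine⇒≢ x∉ z∈ refl = x∉ z∈

  gap≡0 : ∀ {z} → OnLine z → gap z ≡ 0#
  gap≡0 {z} z∈ = trans (cong (_- line z) z∈) (R.-‿inverseʳ (line z))

  gap≢0 : ∀ {x} → ¬ OnLine x → gap x ≢ 0#
  gap≢0 x∉ gap≡0 = x∉ (x∙y⁻¹≈ε⇒x≈y _ _ gap≡0)

  φx-φz≡gap+m*[x-z] : ∀ x {z} → OnLine z → φ x - φ z ≡ gap x + m * (x - z)
  φx-φz≡gap+m*[x-z] x {z} z∈ = begin
    φ x - φ z                     ≡⟨ cong (λ t → φ x - t) z∈ ⟩
    φ x - line z                  ≡⟨ x-z≡[x-y]+[y-z] (φ x) (line x) (line z) ⟩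
    gap x + (line x - line z)     ≡⟨ cong (gap x +_) ([x+w]-[y+w]≡x-y (m * x) (m * z) b) ⟩
    gap x + (m * x - m * z)       ≡⟨ cong (gap x +_) (x[y-z]≈xy-xz m x z) ⟨
    gap x + m * (x - z)           ∎

  slope-m≡gap/[x-z] : ∀ {x z} → OnLine z → x ≢ z → slope x z - m ≡ gap x / (x - z)
  slope-m≡gap/[x-z] {x} {z} z∈ x≢z = begin
    (φ x - φ z) / (x - z) - m           ≡⟨ cong (λ t → t / (x - z) - m) (φx-φz≡gap+m*[x-z] x z∈) ⟩
    (gap x + m * (x - z)) / (x - z) - m ≡⟨ cong (_- m) (R.distribʳ ((x - z) ⁻¹) (gap x) _) ⟩
    gap x / (x - z) + m * (x - z) / (x - z) - m
                                        ≡⟨ cong (λ t → gap x / (x - z) + t - m) (x*y/y≡x m (x≢y⇒x-y≢0 x≢z)) ⟩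
    gap x / (x - z) + m - m             ≡⟨ //-rightDividesʳ m (gap x / (x - z)) ⟩
    gap x / (x - z)                     ∎

  slope-m≡0 : ∀ {x z} → OnLine x → OnLine z → x ≢ z → slope x z - m ≡ 0#
  slope-m≡0 {x} {z} x∈ z∈ x≢z = begin
    slope x z - m     ≡⟨ slope-m≡gap/[x-z] z∈ x≢z ⟩
    gap x / (x - z)   ≡⟨ cong (_/ (x - z)) (gap≡0 x∈) ⟩
    0# / (x - z)      ≡⟨ R.zeroˡ ((x - z) ⁻¹) ⟩
    0#                ∎

  slope-m≢0 : ∀ {x z} → ¬ OnLine x → OnLine z → slope x z - m ≢ 0#
  slope-m≢0 {x} {z} x∉ z∈ = subst (_≢ 0#) (sym (slope-m≡gap/[x-z] z∈ x≢z))
    (x/y≢0 (gap≢0 x∉) (x≢y⇒x-y≢0 x≢z))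
    where x≢z = offLine⇒≢ x∉ z∈

  slope-quotient : ∀ {x z₀ z₁} → ¬ OnLine x → OnLine z₀ → OnLine z₁ →
    (slope x z₀ - m) ⁻¹ * (slope x z₁ - m) ≡ (x - z₀) / (x - z₁)
  slope-quotient {x} {z₀} {z₁} x∉ z₀∈ z₁∈ = begin
    (slope x z₀ - m) ⁻¹ * (slope x z₁ - m)
      ≡⟨ cong₂ (λ s t → s ⁻¹ * t) (slope-m≡gap/[x-z] z₀∈ x≢z₀) (slope-m≡gap/[x-z] z₁∈ x≢z₁) ⟩
    (gap x / (x - z₀)) ⁻¹ * (gap x / (x - z₁))
      ≡⟨ [x/y]⁻¹*[x/z]≡y/z (x - z₁) (gap≢0 x∉) (x≢y⇒x-y≢0 x≢z₀) ⟩
    (x - z₀) / (x - z₁) ∎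
    where x≢z₀ = offLine⇒≢ x∉ z₀∈
          x≢z₁ = offLine⇒≢ x∉ z₁∈

  quotient∈ : ∀ {x z x′ z′} → x ≢ z → x′ ≢ z′ → slope x z - m ≢ 0# →
    InQuotSet F φ m ((slope x z - m) ⁻¹ * (slope x′ z′ - m))
  quotient∈ x≢z x′≢z′ a≢0 = _ , _ , slope∈directions x≢z , slope∈directions x′≢z′ , a≢0 , refl

  module _ {z₀ z₁} (z₀∈ : OnLine z₀) (z₁∈ : OnLine z₁) (z₀≢z₁ : z₀ ≢ z₁) where
    open CrossRatio z₀≢z₁

    0∈quotientSet : ∀ {x} → ¬ OnLine x → InQuotSet F φ m 0#
    0∈quotientSet {x} x∉ = subst (InQuotSet F φ m)
      (trans (cong ((slope x z₀ - m) ⁻¹ *_) (slope-m≡0 z₁∈ z₀∈ (z₀≢z₁ ∘ sym))) (R.zeroʳ _))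
      (quotient∈ (offLine⇒≢ x∉ z₀∈) (z₀≢z₁ ∘ sym) (slope-m≢0 x∉ z₀∈))

    1∈quotientSet : ∀ {x} → ¬ OnLine x → InQuotSet F φ m 1#
    1∈quotientSet x∉ = subst (InQuotSet F φ m) (⁻¹-inverseˡ (slope-m≢0 x∉ z₀∈))
      (quotient∈ (offLine⇒≢ x∉ z₀∈) (offLine⇒≢ x∉ z₀∈) (slope-m≢0 x∉ z₀∈))

    ratio∈quotientSet : ∀ {x} → ¬ OnLine x → InQuotSet F φ m (ratio x)
    ratio∈quotientSet x∉ = subst (InQuotSet F φ m) (slope-quotient x∉ z₀∈ z₁∈)
      (quotient∈ (offLine⇒≢ x∉ z₀∈) (offLine⇒≢ x∉ z₁∈) (slope-m≢0 x∉ z₀∈))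

    distinct-quotients : ∀ {x} → ¬ OnLine x → ∀ {xs} → All (∁ OnLine) xs → Unique xs →
      ∃[ L ] (Unique L × All (InQuotSet F φ m) L × length L ≡ suc (suc (length xs)))
    distinct-quotients x∉ {xs} xs∉ xs! =
        0# ∷ 1# ∷ map ratio xs
      , (0≢1 ∷ map⁺ (All.map (λ y∉ → ratio≢0 (y≢z₀ y∉) (y≢z₁ y∉) ∘ sym) xs∉))
        ∷ map⁺ (All.map (λ y∉ → ratio≢1 (y≢z₁ y∉) ∘ sym) xs∉)
        ∷ Unique-map⁺ (λ y∉ y′∉ → ratio-injective (y≢z₁ y∉) (y≢z₁ y′∉)) xs∉ xs!
      , 0∈quotientSet x∉ ∷ 1∈quotientSet x∉ ∷ map⁺ (All.map ratio∈quotientSet xs∉)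
      , cong (suc ∘ suc) (length-map ratio xs)
      where
      y≢z₀ : ∀ {y} → ¬ OnLine y → y ≢ z₀
      y≢z₀ y∉ = offLine⇒≢ y∉ z₀∈
      y≢z₁ : ∀ {y} → ¬ OnLine y → y ≢ z₁
      y≢z₁ y∉ = offLine⇒≢ y∉ z₁∈

  offLine : List Carrier
  offLine = filter (∁? onLine?) elements

  offLine∉ : All (∁ OnLine) offLine
  offLine∉ = all-filter (∁? onLine?) elements

  quotientSet-large : 1 < length (filter onLine? elements) → 0 < length offLine →
    ∃[ L ] (Unique L × All (InQuotSet F φ m) L × length L ≡ suc (suc (length offLine)))
  quotientSet-large 1<|onLine| 0<|offLine|
    with z₀ , z₁ , z₀∈ , z₁∈ , z₀≢z₁ ← All-Unique⇒distinct-pair 1<|onLine|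
           (all-filter onLine? elements) (filter⁺ onLine? elements-unique)
       | x , x∉ ← All-nonempty⇒∃ 0<|offLine| offLine∉
    = distinct-quotients z₀∈ z₁∈ z₀≢z₁ x∉ offLine∉ (filter⁺ (∁? onLine?) elements-unique)

-- Not imported above, where it would clash with the field's _+_.
open import Data.Nat using (_+_)

module _ {A : Set} {P : Pred A 0ℓ} (P? : Decidable P) where

  length-filter+length-filter-∁ : ∀ xs →
    length (filter P? xs) + length (filter (∁? P?) xs) ≡ length xs
  length-filter+length-filter-∁ [] = refl
  length-filter+length-filter-∁ (x ∷ xs) with P? x
  ... | yes _ = cong suc (length-filter+length-filter-∁ xs)
  ... | no  _ = trans (+-suc _ _) (cong suc (length-filter+length-filter-∁ xs))

theorem1 : (F : FiniteField) → (p n : ℕ) → Prime p → FiniteField.size F ≡ p ^ n →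
    (f : Poly F) → (m b : FiniteField.Carrier F) → (k : ℕ) →
    intersectionCount F (eval F f) m b ≡ k → 1 < k → k < FiniteField.size F →
    ∃[ L ] (Unique L × All (InQuotSet F (eval F f) m) L ×
      (FiniteField.size F ∸ k) + 2 ≤ length L)
theorem1 F _ _ _ _ f m b k onLine-count 1<k k<q =
  let L , L! , L⊆Q , |L|≡2+|offLine| = quotientSet-large
        (subst (1 <_) (sym onLine-count) 1<k)
        (subst (0 <_) (sym |offLine|≡q∸k) (m<n⇒0<n∸m k<q))
  in L , L! , L⊆Q , ≤-reflexive (begin
    size ∸ k + 2         ≡⟨ +-comm (size ∸ k) 2 ⟩
    2 + (size ∸ k)       ≡⟨ cong (2 +_) |offLine|≡q∸k ⟨
    2 + length offLine   ≡⟨ |L|≡2+|offLine| ⟨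
    length L             ∎)
  where
  open FiniteField F using (size; elements)
  open Secants F (eval F f) m b using (onLine?; offLine; quotientSet-large)
  open ≡-Reasoning

  |offLine|≡q∸k : length offLine ≡ size ∸ k
  |offLine|≡q∸k = begin
    length offLine                                          ≡⟨ m+n∸m≡n k _ ⟨
    k + length offLine ∸ k                                  ≡⟨ cong (λ j → j + length offLine ∸ k) onLine-count ⟨
    length (filter onLine? elements) + length offLine ∸ k   ≡⟨ cong (_∸ k) (length-filter+length-filter-∁ onLine? elements) ⟩
    size ∸ k                                                ∎
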